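{- Let $G=(U,V,E)$ be a bipartite graph, $F\subseteq E$, and let $(E_r,E_b)$ be an $(A,C)$-free bipartition of the set $E_c$ of committed edges of $G$. Fix a non-edge $uv\in\hat{E}$ ($u\in U$, $v\in V$) and define $H_r=\{u'v'\in E_r : uv'\in E_b,\ u'v\in E_b\}$, $H_b=\{u'v'\in E_b : uv'\in E_r,\ u'v\in E_r\}$, $H=H_r\cup H_b$, and $E_r'=(E_r\setminus H_r)\cup H_b$, $E_b'=(E_b\setminus H_b)\cup H_r$. Then no edge of $H$ is an edge of any forbidden configuration $(A_1)$, $(A_2)$, $(B_1)$, $(B_2)$ or $(C)$ of the bipartition $(E_r',E_b')$ of $E_c$.
   Context: Let $\hat{E}=\{xy: x\in U, y\in V, xy\notin E\}$. Two edges $u_1v_1,u_2v_2\in E$ ($u_i\in U$, $v_i\in V$) are in conflict in $G$ if $u_1v_2,u_2v_1\in\hat{E}$. An edge is committed if it is in conflict with some other edge of $E$; $E_c$ is the set of committed edges. A bipartition of $E_c$ is a pair $(E_r,E_b)$ partitioning $E_c$ with $F\cap E_c\subseteq E_b$. For a pair $(R,B)$ partitioning $E_c$, the forbidden configurations on vertices $u_1,u_2\in U$, $v_1,v_2\in V$ are: $(A_1)$: $u_1v_1,u_2v_2\in R$, $u_1v_2,u_2v_1\in\hat{E}$; $(A_2)$: $u_1v_1,u_2v_2\in B$, $u_1v_2,u_2v_1\in\hat{E}$; $(B_1)$: $u_1v_1,u_2v_2\in R$, $u_1v_2\in\hat{E}$, $u_2v_1\in B$; $(B_2)$: $u_1v_1,u_2v_2\in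 B$, $u_1v_2\in\hat{E}$, $u_2v_1\in R$; $(C)$: $u_1v_1,u_2v_2\in R$, $u_1v_2\in\hat{E}$, $u_2v_1\in F$. A bipartition is $(A,C)$-free if it contains none of $(A_1)$, $(A_2)$, $(C)$. -}

module Defs where

open import Data.Nat using (ℕ)
open import Data.Fin using (Fin)
open import Data.Bool using (Bool; true; false; _∧_; _∨_; not)
open import Data.Product using (_×_; ∃-syntax)
open import Data.Sum using (_⊎_)
open import Relation.Nullary using (¬_)
open import Relation.Binary.PropositionalEquality using (_≡_)

-- A bipartite graph G = (U,V,E) with U = Fin m, V = Fin n.
-- A set of (potential) edges between U and V is a Bool-valued
-- characteristic function; xy ∈ S means S x y ≡ true.
EdgeSet : ℕ → ℕ → Set
EdgeSet m n = Fin m → Fin n → Bool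

module _ {m n : ℕ} where

  NonEdge : EdgeSet m n → Fin m → Fin n → Set
  NonEdge E x y = E x y ≡ false

  Conflict : EdgeSet m n → Fin m → Fin n → Fin m → Fin n → Set
  Conflict E u₁ v₁ u₂ v₂ =
    E u₁ v₁ ≡ true × E u₂ v₂ ≡ true × NonEdge E u₁ v₂ × NonEdge E u₂ v₁

  Committed : EdgeSet m n → Fin m → Fin n → Set
  Committed E x y = E x y ≡ true × ∃[ x' ] ∃[ y' ] Conflict E x y x' y'

  PartitionsEc : EdgeSet m n → EdgeSet m n → EdgeSet m n → Set
  PartitionsEc E R B =
    (∀ x y → (R x y ≡ true ⊎ B x y ≡ true) → Committed E x y) ×
    (∀ x y → Committed E x y → R x y ≡ true ⊎ B x y ≡ true) ×
    (∀ x y → R x y ≡ true → B x y ≡ true → Data.Empty.⊥)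
    where import Data.Empty

  Bipartition : EdgeSet m n → EdgeSet m n → EdgeSet m n → EdgeSet m n → Set
  Bipartition E F Er Eb =
    PartitionsEc E Er Eb ×
    (∀ x y → F x y ≡ true → Committed E x y → Eb x y ≡ true)

  ConfA₁ : EdgeSet m n → EdgeSet m n → Fin m → Fin m → Fin n → Fin n → Set
  ConfA₁ E R u₁ u₂ v₁ v₂ =
    R u₁ v₁ ≡ true × R u₂ v₂ ≡ true × NonEdge E u₁ v₂ × NonEdge E u₂ v₁

  ConfA₂ : EdgeSet m n → EdgeSet m n → Fin m → Fin m → Fin n → Fin n → Set
  ConfA₂ E B u₁ u₂ v₁ v₂ =
    B u₁ v₁ ≡ true × B u₂ v₂ ≡ true × NonEdge E u₁ v₂ × NonEdge E u₂ v₁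

  ConfB₁ : EdgeSet m n → EdgeSet m n → EdgeSet m n → Fin m → Fin m → Fin n → Fin n → Set
  ConfB₁ E R B u₁ u₂ v₁ v₂ =
    R u₁ v₁ ≡ true × R u₂ v₂ ≡ true × NonEdge E u₁ v₂ × B u₂ v₁ ≡ true

  ConfB₂ : EdgeSet m n → EdgeSet m n → EdgeSet m n → Fin m → Fin m → Fin n → Fin n → Set
  ConfB₂ E R B u₁ u₂ v₁ v₂ =
    B u₁ v₁ ≡ true × B u₂ v₂ ≡ true × NonEdge E u₁ v₂ × R u₂ v₁ ≡ true

  ConfC : EdgeSet m n → EdgeSet m n → EdgeSet m n → Fin m → Fin m → Fin n → Fin n → Set
  ConfC E F R u₁ u₂ v₁ v₂ =
    R u₁ v₁ ≡ true × R u₂ v₂ ≡ true × NonEdge E u₁ v₂ × F u₂ v₁ ≡ true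

  ACFree : EdgeSet m n → EdgeSet m n → EdgeSet m n → EdgeSet m n → Set
  ACFree E F R B = ∀ u₁ u₂ v₁ v₂ →
    ¬ ConfA₁ E R u₁ u₂ v₁ v₂ × ¬ ConfA₂ E B u₁ u₂ v₁ v₂ × ¬ ConfC E F R u₁ u₂ v₁ v₂

  Hr : EdgeSet m n → EdgeSet m n → Fin m → Fin n → EdgeSet m n
  Hr Er Eb u v u' v' = Er u' v' ∧ Eb u v' ∧ Eb u' v

  Hb : EdgeSet m n → EdgeSet m n → Fin m → Fin n → EdgeSet m n
  Hb Er Eb u v u' v' = Eb u' v' ∧ Er u v' ∧ Er u' v

  H : EdgeSet m n → EdgeSet m n → Fin m → Fin n → EdgeSet m n
  H Er Eb u v u' v' = Hr Er Eb u v u' v' ∨ Hb Er Eb u v u' v'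

  Er′ : EdgeSet m n → EdgeSet m n → Fin m → Fin n → EdgeSet m n
  Er′ Er Eb u v x y = (Er x y ∧ not (Hr Er Eb u v x y)) ∨ Hb Er Eb u v x y

  Eb′ : EdgeSet m n → EdgeSet m n → Fin m → Fin n → EdgeSet m n
  Eb′ Er Eb u v x y = (Eb x y ∧ not (Hb Er Eb u v x y)) ∨ Hr Er Eb u v x y

  -- The edges of a configuration on u1,u2,v1,v2 are u1v1, u2v2 (and, for
  -- (B1),(B2),(C), also u2v1); u1v2 (and u2v1 in (A)) are non-edges.
  -- "No edge of S lies in any forbidden configuration of (R,B)":
  NoEdgeInForbidden : EdgeSet m n → EdgeSet m n → EdgeSet m n → EdgeSet m n → EdgeSet m n → Set
  NoEdgeInForbidden E F R B S = ∀ u₁ u₂ v₁ v₂ →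
    (ConfA₁ E R u₁ u₂ v₁ v₂ → ¬ S u₁ v₁ ≡ true × ¬ S u₂ v₂ ≡ true) ×
    (ConfA₂ E B u₁ u₂ v₁ v₂ → ¬ S u₁ v₁ ≡ true × ¬ S u₂ v₂ ≡ true) ×
    (ConfB₁ E R B u₁ u₂ v₁ v₂ → ¬ S u₁ v₁ ≡ true × ¬ S u₂ v₂ ≡ true × ¬ S u₂ v₁ ≡ true) ×
    (ConfB₂ E R B u₁ u₂ v₁ v₂ → ¬ S u₁ v₁ ≡ true × ¬ S u₂ v₂ ≡ true × ¬ S u₂ v₁ ≡ true) ×
    (ConfC E F R u₁ u₂ v₁ v₂ → ¬ S u₁ v₁ ≡ true × ¬ S u₂ v₂ ≡ true × ¬ S u₂ v₁ ≡ true)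

-- Let P be the colour class of an edge xy of H and Q the other one, so that the
-- corners uy and xv of xy lie in Q and the swap moves xy into Q′. If xy lay in a
-- forbidden configuration of (E_r′, E_b′) together with an edge x′y′, then,
-- because conflicting edges receive different colours and (E_r, E_b) is A-free,
-- the corners uy′ and x′v of x′y′ would be edges of the colour opposite to that
-- of x′y′. This puts x′y′ into H as well, contradicting the colour it has in the
-- configuration. For (C) the same argument runs on C-freeness of E_r, together
-- with F ∩ E_c ⊆ E_b.
module Submission where

open import Defs
open import Data.Nat using (ℕ)
open import Data.Fin using (Fin)
open import Data.Bool using (true; false; _∧_; _∨_; not)
open import Data.Bool.Properties using (¬-not)
open import Data.Product using (_×_; _,_; proj₁; proj₂; ∃-syntax; zip′)
open import Data.Sum using (_⊎_; inj₁; inj₂; [_,_]′; swap)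
open import Data.Empty using (⊥; ⊥-elim)
open import Function using (id; _∘_; flip)
open import Relation.Nullary using (¬_)
open import Relation.Binary.PropositionalEquality using (_≡_; refl)

private
  variable
    m n : ℕ
    E F P Q R B S T : EdgeSet m n
    a c x y : Fin m
    b d v w : Fin n

∨-true : ∀ p {q} → p ∨ q ≡ true → p ≡ true ⊎ q ≡ true
∨-true true  _ = inj₁ refl
∨-true false h = inj₂ h

∧₃-true : ∀ {p q r} → p ∧ q ∧ r ≡ true → p ≡ true × q ≡ true × r ≡ true
∧₃-true {true} {true} {true} _ = refl , refl , refl

∧-not-∧₃ : ∀ p q r → p ∧ not (p ∧ q ∧ r) ≡ true → p ≡ true × (q ≡ true → r ≡ true → ⊥)
∧-not-∧₃ true true  true  ()
∧-not-∧₃ true true  false _ = refl , λ _ ()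
∧-not-∧₃ true false _     _ = refl , λ ()

Er′-cases : {u : Fin m} {v : Fin n} → Er′ P Q u v x b ≡ true →
  (P x b ≡ true × (Q u b ≡ true → Q x v ≡ true → ⊥)) ⊎
  (Q x b ≡ true × P u b ≡ true × P x v ≡ true)
Er′-cases {P = P} {Q = Q} {x = x} {b = b} {u = u} {v = v} h
  with ∨-true (P x b ∧ not (Hr P Q u v x b)) h
... | inj₁ kept  = inj₁ (∧-not-∧₃ (P x b) (Q u b) (Q x v) kept)
... | inj₂ moved = inj₂ (∧₃-true moved)

AFree : EdgeSet m n → EdgeSet m n → Set
AFree E S = ∀ {u₁ u₂ v₁ v₂} → ¬ ConfA₁ E S u₁ u₂ v₁ v₂

CFree : EdgeSet m n → EdgeSet m n → EdgeSet m n → Set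
CFree E F S = ∀ {u₁ u₂ v₁ v₂} → ¬ ConfC E F S u₁ u₂ v₁ v₂

Conflict-sym : Conflict E a b c d → Conflict E c d a b
Conflict-sym (ab∈E , cd∈E , ad∉E , cb∉E) = cd∈E , ab∈E , cb∉E , ad∉E

PartitionsEc-swap : PartitionsEc E P Q → PartitionsEc E Q P
PartitionsEc-swap (coloured⇒committed , committed⇒coloured , disjoint) =
  (λ x y → coloured⇒committed x y ∘ swap) ,
  (λ x y → swap ∘ committed⇒coloured x y) ,
  (λ x y → flip (disjoint x y))

NoEdgeInForbidden-∪ : NoEdgeInForbidden E F R B S → NoEdgeInForbidden E F R B T →
  NoEdgeInForbidden E F R B (λ x y → S x y ∨ T x y)
NoEdgeInForbidden-∪ {S = S} {T = T} S-free T-free u₁ u₂ v₁ v₂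
  with S-free u₁ u₂ v₁ v₂ | T-free u₁ u₂ v₁ v₂
... | sA₁ , sA₂ , sB₁ , sB₂ , sC | tA₁ , tA₂ , tB₁ , tB₂ , tC =
  pair sA₁ tA₁ , pair sA₂ tA₂ , triple sB₁ tB₁ , triple sB₂ tB₂ , triple sC tC
  where
  _∉_ : Fin _ × Fin _ → EdgeSet _ _ → Set
  (x , b) ∉ S = ¬ S x b ≡ true
  ∪ : EdgeSet _ _
  ∪ x b = S x b ∨ T x b
  ∉S∪T : ∀ {e} → e ∉ S → e ∉ T → e ∉ ∪
  ∉S∪T {x , b} x∉S x∉T h = [ x∉S , x∉T ]′ (∨-true (S x b) h)
  pair : {K : Set} {e₁ e₂ : Fin _ × Fin _} →
    (K → e₁ ∉ S × e₂ ∉ S) → (K → e₁ ∉ T × e₂ ∉ T) → K → e₁ ∉ ∪ × e₂ ∉ ∪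
  pair s t k = zip′ ∉S∪T ∉S∪T (s k) (t k)
  triple : {K : Set} {e₁ e₂ e₃ : Fin _ × Fin _} →
    (K → e₁ ∉ S × e₂ ∉ S × e₃ ∉ S) → (K → e₁ ∉ T × e₂ ∉ T × e₃ ∉ T) →
    K → e₁ ∉ ∪ × e₂ ∉ ∪ × e₃ ∉ ∪
  triple s t k = zip′ ∉S∪T (zip′ ∉S∪T ∉S∪T) (s k) (t k)

module Colouring {E P Q : EdgeSet m n} (partition : PartitionsEc E P Q)
  (P-AFree : AFree E P) (Q-AFree : AFree E Q) where

  disjoint : P a b ≡ true → Q a b ≡ true → ⊥
  disjoint = proj₂ (proj₂ partition) _ _

  P-cross-edge : P a b ≡ true → P c d ≡ true → NonEdge E a d → E c b ≡ true
  P-cross-edge ab∈P cd∈P ad∉E = ¬-not λ cb∉E → P-AFree (ab∈P , cd∈P , ad∉E , cb∉E)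

  coloured⇒E : P a b ≡ true ⊎ Q a b ≡ true → E a b ≡ true
  coloured⇒E ab∈P∪Q = proj₁ (proj₁ partition _ _ ab∈P∪Q)

  coloured⇒conflict : P a b ≡ true ⊎ Q a b ≡ true → ∃[ c ] ∃[ d ] Conflict E a b c d
  coloured⇒conflict ab∈P∪Q = proj₂ (proj₁ partition _ _ ab∈P∪Q)

  conflict⇒coloured : Conflict E a b c d → P a b ≡ true ⊎ Q a b ≡ true
  conflict⇒coloured ab⋈cd = proj₁ (proj₂ partition) _ _ (proj₁ ab⋈cd , _ , _ , ab⋈cd)

  conflict-¬Q⇒P : Conflict E a b c d → ¬ Q a b ≡ true → P a b ≡ true
  conflict-¬Q⇒P ab⋈cd ab∉Q = [ id , ⊥-elim ∘ ab∉Q ]′ (conflict⇒coloured ab⋈cd)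

  conflict-Q⇒P : Conflict E a b c d → Q c d ≡ true → P a b ≡ true
  conflict-Q⇒P ab⋈cd@(_ , _ , ad∉E , cb∉E) cd∈Q =
    conflict-¬Q⇒P ab⋈cd λ ab∈Q → Q-AFree (ab∈Q , cd∈Q , ad∉E , cb∉E)

  -- Otherwise the partner cd of the P-edge ab would also conflict with the
  -- Q-edge xb (resp. aw), so it could have neither colour.
  partner-in-column : Conflict E a b c d → P a b ≡ true → Q x b ≡ true → E x d ≡ true
  partner-in-column ab⋈cd@(_ , cd∈E , ad∉E , cb∉E) ab∈P xb∈Q = ¬-not λ xd∉E →
    [ (λ cd∈P → P-AFree (ab∈P , cd∈P , ad∉E , cb∉E))
    , (λ cd∈Q → Q-AFree (cd∈Q , xb∈Q , cb∉E , xd∉E))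
    ]′ (conflict⇒coloured (Conflict-sym {E = E} ab⋈cd))

  partner-in-row : Conflict E a b c d → P a b ≡ true → Q a w ≡ true → E c w ≡ true
  partner-in-row ab⋈cd@(_ , cd∈E , ad∉E , cb∉E) ab∈P aw∈Q = ¬-not λ cw∉E →
    [ (λ cd∈P → P-AFree (ab∈P , cd∈P , ad∉E , cb∉E))
    , (λ cd∈Q → Q-AFree (aw∈Q , cd∈Q , ad∉E , cw∉E))
    ]′ (conflict⇒coloured (Conflict-sym {E = E} ab⋈cd))

module Recolouring {E P Q : EdgeSet m n} (partition : PartitionsEc E P Q)
  (P-AFree : AFree E P) (Q-AFree : AFree E Q)
  (u : Fin m) (v : Fin n) (uv∉E : NonEdge E u v) where

  open Colouring partition P-AFree Q-AFree
  open Colouring (PartitionsEc-swap partition) Q-AFree P-AFree using ()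
    renaming ( conflict-Q⇒P to conflict-P⇒Q; P-cross-edge to Q-cross-edge
             ; partner-in-column to Q-partner-in-column; partner-in-row to Q-partner-in-row )

  P′ Q′ Hᴾ : EdgeSet m n
  P′ = Er′ P Q u v
  Q′ = Eb′ P Q u v
  Hᴾ = Hr P Q u v

  P′-cases : P′ a b ≡ true →
    (P a b ≡ true × (Q u b ≡ true → Q a v ≡ true → ⊥)) ⊎
    (Q a b ≡ true × P u b ≡ true × P a v ≡ true)
  P′-cases = Er′-cases {P = P} {Q = Q} {u = u} {v = v}

  Q′-cases : Q′ a b ≡ true →
    (Q a b ≡ true × (P u b ≡ true → P a v ≡ true → ⊥)) ⊎
    (P a b ≡ true × Q u b ≡ true × Q a v ≡ true)
  Q′-cases = Er′-cases {P = Q} {Q = P} {u = u} {v = v}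

  Hᴾ⊆P : Hᴾ a b ≡ true → P a b ≡ true
  Hᴾ⊆P {a} {b} ab∈Hᴾ = proj₁ (∧₃-true {P a b} {Q u b} {Q a v} ab∈Hᴾ)

  ¬F-between : CFree E F Q → Q u b ≡ true → Q a v ≡ true → ¬ F a b ≡ true
  ¬F-between Q-CFree ub∈Q av∈Q ab∈F = Q-CFree (ub∈Q , av∈Q , uv∉E , ab∈F)

  module _ {x : Fin m} {y : Fin n} (xy∈Hᴾ : Hᴾ x y ≡ true) where

    private
      Hᴾ-parts : P x y ≡ true × Q u y ≡ true × Q x v ≡ true
      Hᴾ-parts = ∧₃-true {P x y} {Q u y} {Q x v} xy∈Hᴾ

      xy∈P : P x y ≡ true
      xy∈P = proj₁ Hᴾ-parts

      uy∈Q : Q u y ≡ true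
      uy∈Q = proj₁ (proj₂ Hᴾ-parts)

      xv∈Q : Q x v ≡ true
      xv∈Q = proj₂ (proj₂ Hᴾ-parts)

      ub∈E : Q a b ≡ true → NonEdge E a y → E u b ≡ true
      ub∈E ab∈Q ay∉E = Q-cross-edge ab∈Q uy∈Q ay∉E

      av∈E : Q a b ≡ true → NonEdge E x b → E a v ≡ true
      av∈E ab∈Q xb∉E = Q-cross-edge xv∈Q ab∈Q xb∉E

      ub∈P : E u b ≡ true → NonEdge E x b → P u b ≡ true
      ub∈P ub∈E xb∉E = conflict-Q⇒P (ub∈E , coloured⇒E (inj₂ xv∈Q) , uv∉E , xb∉E) xv∈Q

      av∈P : E a v ≡ true → NonEdge E a y → P a v ≡ true
      av∈P av∈E ay∉E = conflict-Q⇒P (av∈E , coloured⇒E (inj₂ uy∈Q) , ay∉E , uv∉E) uy∈Q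

    Hᴾ∉P′ : ¬ P′ x y ≡ true
    Hᴾ∉P′ xy∈P′ with P′-cases xy∈P′
    ... | inj₁ (_ , xy∉Hᴾ) = xy∉Hᴾ uy∈Q xv∈Q
    ... | inj₂ (xy∈Q , _)  = disjoint xy∈P xy∈Q

    Hᴾ∉A : ∀ {x′ y′} → ¬ ConfA₁ E Q′ x x′ y y′
    Hᴾ∉A (_ , x′y′∈Q′ , xy′∉E , x′y∉E) with Q′-cases x′y′∈Q′
    ... | inj₂ (x′y′∈P , _) = P-AFree (xy∈P , x′y′∈P , xy′∉E , x′y∉E)
    ... | inj₁ (x′y′∈Q , x′y′∉Hᵠ) =
      x′y′∉Hᵠ (ub∈P (ub∈E x′y′∈Q x′y∉E) xy′∉E) (av∈P (av∈E x′y′∈Q xy′∉E) x′y∉E)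

    Hᴾ∉B-left : ∀ {x′ y′} → ¬ ConfB₁ E Q′ P′ x x′ y y′
    Hᴾ∉B-left (_ , x′y′∈Q′ , xy′∉E , x′y∈P′) with P′-cases x′y∈P′ | Q′-cases x′y′∈Q′
    ... | inj₂ (_ , uy∈P , _) | _ = disjoint uy∈P uy∈Q
    ... | inj₁ (_ , x′y∉Hᴾ) | inj₂ (_ , _ , x′v∈Q) = x′y∉Hᴾ uy∈Q x′v∈Q
    ... | inj₁ (x′y∈P , x′y∉Hᴾ) | inj₁ (x′y′∈Q , x′y′∉Hᵠ)
      with coloured⇒conflict (inj₁ x′y∈P)
    ... | _ , b , x′y⋈ab@(_ , _ , x′b∉E , _) = x′y′∉Hᵠ uy′∈P x′v∈P
      where
      x′v⋈ub : Conflict E _ v u b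
      x′v⋈ub = av∈E x′y′∈Q xy′∉E , partner-in-column x′y⋈ab x′y∈P uy∈Q , x′b∉E , uv∉E
      x′v∈P : P _ v ≡ true
      x′v∈P = conflict-¬Q⇒P x′v⋈ub (x′y∉Hᴾ uy∈Q)
      ub∈Q : Q u b ≡ true
      ub∈Q = conflict-P⇒Q (Conflict-sym {E = E} x′v⋈ub) x′v∈P
      uy′∈P : P u _ ≡ true
      uy′∈P = ub∈P (Q-cross-edge x′y′∈Q ub∈Q x′b∉E) xy′∉E

    Hᴾ∉B-right : ∀ {x′ y′} → ¬ ConfB₁ E Q′ P′ x′ x y′ y
    Hᴾ∉B-right (x′y′∈Q′ , _ , x′y∉E , xy′∈P′) with P′-cases xy′∈P′ | Q′-cases x′y′∈Q′
    ... | inj₂ (_ , _ , xv∈P) | _ = disjoint xv∈P xv∈Q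
    ... | inj₁ (_ , xy′∉Hᴾ) | inj₂ (_ , uy′∈Q , _) = xy′∉Hᴾ uy′∈Q xv∈Q
    ... | inj₁ (xy′∈P , xy′∉Hᴾ) | inj₁ (x′y′∈Q , x′y′∉Hᵠ)
      with coloured⇒conflict (inj₁ xy′∈P)
    ... | a , _ , xy′⋈ab@(_ , _ , _ , ay′∉E) = x′y′∉Hᵠ uy′∈P x′v∈P
      where
      uy′⋈av : Conflict E u _ a v
      uy′⋈av = ub∈E x′y′∈Q x′y∉E , partner-in-row xy′⋈ab xy′∈P xv∈Q , uv∉E , ay′∉E
      uy′∈P : P u _ ≡ true
      uy′∈P = conflict-¬Q⇒P uy′⋈av (λ uy′∈Q → xy′∉Hᴾ uy′∈Q xv∈Q)
      av∈Q : Q a v ≡ true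
      av∈Q = conflict-P⇒Q (Conflict-sym {E = E} uy′⋈av) uy′∈P
      x′v∈P : P _ v ≡ true
      x′v∈P = av∈P (Q-cross-edge av∈Q x′y′∈Q ay′∉E) x′y∉E

    Hᴾ∉B-cross : ∀ {x′ y′} → ¬ ConfB₁ E P′ Q′ x′ x y y′
    Hᴾ∉B-cross (x′y∈P′ , xy′∈P′ , x′y′∉E , _) with P′-cases x′y∈P′ | P′-cases xy′∈P′
    ... | inj₂ (_ , uy∈P , _) | _ = disjoint uy∈P uy∈Q
    ... | inj₁ _ | inj₂ (_ , _ , xv∈P) = disjoint xv∈P xv∈Q
    ... | inj₁ (x′y∈P , x′y∉Hᴾ) | inj₁ (xy′∈P , xy′∉Hᴾ)
      with coloured⇒conflict (inj₁ xy∈P)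
    ... | _ , _ , xy⋈ab@(_ , _ , xb∉E , ay∉E) = P-AFree (x′v∈P , uy′∈P , x′y′∉E , uv∉E)
      where
      x′v⋈uy′ : Conflict E _ v u _
      x′v⋈uy′ = P-cross-edge (av∈P (partner-in-row xy⋈ab xy∈P xv∈Q) ay∉E) x′y∈P ay∉E
              , P-cross-edge xy′∈P (ub∈P (partner-in-column xy⋈ab xy∈P uy∈Q) xb∉E) xb∉E
              , x′y′∉E , uv∉E
      x′v∈P : P _ v ≡ true
      x′v∈P = conflict-¬Q⇒P x′v⋈uy′ (x′y∉Hᴾ uy∈Q)
      uy′∈P : P u _ ≡ true
      uy′∈P = conflict-¬Q⇒P (Conflict-sym {E = E} x′v⋈uy′) (λ uy′∈Q → xy′∉Hᴾ uy′∈Q xv∈Q)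

    module _ {F : EdgeSet m n} (Q-CFree : CFree E F Q) where

      Hᴾ∉F : ¬ F x y ≡ true
      Hᴾ∉F = ¬F-between Q-CFree uy∈Q xv∈Q

      Hᴾ∉C-left : ∀ {x′ y′} → ¬ ConfC E F Q′ x x′ y y′
      Hᴾ∉C-left (_ , x′y′∈Q′ , xy′∉E , x′y∈F) with Q′-cases x′y′∈Q′
      ... | inj₂ (_ , _ , x′v∈Q) = ¬F-between Q-CFree uy∈Q x′v∈Q x′y∈F
      ... | inj₁ (x′y′∈Q , x′y′∉Hᵠ) with coloured⇒conflict (inj₂ x′y′∈Q)
      ... | _ , _ , x′y′⋈ab@(_ , _ , x′b∉E , _) = x′y′∉Hᵠ uy′∈P x′v∈P
        where
        uy′∈P : P u _ ≡ true
        uy′∈P = ub∈P (¬-not λ uy′∉E → Q-CFree (uy∈Q , x′y′∈Q , uy′∉E , x′y∈F)) xy′∉E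
        x′v∈P : P _ v ≡ true
        x′v∈P = conflict-¬Q⇒P
          (av∈E x′y′∈Q xy′∉E , Q-partner-in-column x′y′⋈ab x′y′∈Q uy′∈P , x′b∉E , uv∉E)
          (λ x′v∈Q → ¬F-between Q-CFree uy∈Q x′v∈Q x′y∈F)

      Hᴾ∉C-right : ∀ {x′ y′} → ¬ ConfC E F Q′ x′ x y′ y
      Hᴾ∉C-right (x′y′∈Q′ , _ , x′y∉E , xy′∈F) with Q′-cases x′y′∈Q′
      ... | inj₂ (_ , uy′∈Q , _) = ¬F-between Q-CFree uy′∈Q xv∈Q xy′∈F
      ... | inj₁ (x′y′∈Q , x′y′∉Hᵠ) with coloured⇒conflict (inj₂ x′y′∈Q)
      ... | _ , _ , x′y′⋈ab@(_ , _ , _ , ay′∉E) = x′y′∉Hᵠ uy′∈P x′v∈P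
        where
        x′v∈P : P _ v ≡ true
        x′v∈P = av∈P (¬-not λ x′v∉E → Q-CFree (x′y′∈Q , xv∈Q , x′v∉E , xy′∈F)) x′y∉E
        uy′∈P : P u _ ≡ true
        uy′∈P = conflict-¬Q⇒P
          (ub∈E x′y′∈Q x′y∉E , Q-partner-in-row x′y′⋈ab x′y′∈Q x′v∈P , uv∉E , ay′∉E)
          (λ uy′∈Q → ¬F-between Q-CFree uy′∈Q xv∈Q xy′∈F)

  Hᴾ-avoids-forbidden : (∀ {a b} → F a b ≡ true → ¬ P a b ≡ true) →
    NoEdgeInForbidden E F P′ Q′ Hᴾ
  Hᴾ-avoids-forbidden F∩P=∅ _ _ _ _ =
      (λ (p₁ , p₂ , _) → (λ h → Hᴾ∉P′ h p₁) , (λ h → Hᴾ∉P′ h p₂))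
    , (λ (q₁ , q₂ , n₁₂ , n₂₁) →
         (λ h → Hᴾ∉A h (q₁ , q₂ , n₁₂ , n₂₁)) , (λ h → Hᴾ∉A h (q₂ , q₁ , n₂₁ , n₁₂)))
    , (λ k@(p₁ , p₂ , _) → (λ h → Hᴾ∉P′ h p₁) , (λ h → Hᴾ∉P′ h p₂) , (λ h → Hᴾ∉B-cross h k))
    , (λ k@(_ , _ , _ , p) → (λ h → Hᴾ∉B-left h k) , (λ h → Hᴾ∉B-right h k) , (λ h → Hᴾ∉P′ h p))
    , (λ (p₁ , p₂ , _ , f) → (λ h → Hᴾ∉P′ h p₁) , (λ h → Hᴾ∉P′ h p₂) , (λ h → F∩P=∅ f (Hᴾ⊆P h)))

  Hᴾ-avoids-forbidden-reversed : CFree E F Q → NoEdgeInForbidden E F Q′ P′ Hᴾ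
  Hᴾ-avoids-forbidden-reversed Q-CFree _ _ _ _ =
      (λ (q₁ , q₂ , n₁₂ , n₂₁) →
         (λ h → Hᴾ∉A h (q₁ , q₂ , n₁₂ , n₂₁)) , (λ h → Hᴾ∉A h (q₂ , q₁ , n₂₁ , n₁₂)))
    , (λ (p₁ , p₂ , _) → (λ h → Hᴾ∉P′ h p₁) , (λ h → Hᴾ∉P′ h p₂))
    , (λ k@(_ , _ , _ , p) → (λ h → Hᴾ∉B-left h k) , (λ h → Hᴾ∉B-right h k) , (λ h → Hᴾ∉P′ h p))
    , (λ k@(p₁ , p₂ , _) → (λ h → Hᴾ∉P′ h p₁) , (λ h → Hᴾ∉P′ h p₂) , (λ h → Hᴾ∉B-cross h k))
    , (λ k@(_ , _ , _ , f) →
         (λ h → Hᴾ∉C-left h Q-CFree k) , (λ h → Hᴾ∉C-right h Q-CFree k) , (λ h → Hᴾ∉F h Q-CFree f))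

lemma2 : {m n : ℕ} (E F Er Eb : EdgeSet m n) →
    (∀ x y → F x y ≡ true → E x y ≡ true) →
    Bipartition E F Er Eb →
    ACFree E F Er Eb →
    (u : Fin m) (v : Fin n) → NonEdge E u v →
    NoEdgeInForbidden E F (Er′ Er Eb u v) (Eb′ Er Eb u v) (H Er Eb u v)
lemma2 E F Er Eb _ (partition , F∩Ec⊆Eb) acFree u v uv∉E =
  NoEdgeInForbidden-∪
    (Recolouring.Hᴾ-avoids-forbidden partition Er-AFree Eb-AFree u v uv∉E F∩Er=∅)
    (Recolouring.Hᴾ-avoids-forbidden-reversed (PartitionsEc-swap partition)
      Eb-AFree Er-AFree u v uv∉E Er-CFree)
  where
  Er-AFree : AFree E Er
  Er-AFree = proj₁ (acFree _ _ _ _)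
  Eb-AFree : AFree E Eb
  Eb-AFree = proj₁ (proj₂ (acFree _ _ _ _))
  Er-CFree : CFree E F Er
  Er-CFree = proj₂ (proj₂ (acFree _ _ _ _))
  F∩Er=∅ : ∀ {x y} → F x y ≡ true → ¬ Er x y ≡ true
  F∩Er=∅ xy∈F xy∈Er =
    proj₂ (proj₂ partition) _ _ xy∈Er (F∩Ec⊆Eb _ _ xy∈F (proj₁ partition _ _ (inj₁ xy∈Er)))
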